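{- Let $T$ be a tree on $n$ vertices with $n\ge s\ge 4$. If $T$ contains a path on $s$ vertices, then the number of (not necessarily induced) subgraphs of $T$ isomorphic to the path $P_4$ on 4 vertices is at most $$f(n,s)=\begin{cases} s-3+2(n-s)+\left\lfloor \frac{n-s}{2}\right\rfloor\left\lceil \frac{n-s}{2}\right\rceil, & \text{if } s\ge 6,\\[2pt] \left\lfloor\frac{n-2}{2}\right\rfloor\left\lceil \frac{n-2}{2}\right\rceil, & \text{if } s=4 \text{ or } s=5.\end{cases}$$ -}

module Defs where

open import Data.Nat using (ℕ; zero; suc; _+_; _*_; _∸_; _≤_; _/_; ⌊_/2⌋; ⌈_/2⌉; _<_; _≤?_)
open import Data.Fin using (Fin; toℕ; fromℕ<; inject₁) renaming (suc to fsuc; zero to fzero)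
open import Data.Fin.Properties using (all?; any?; _≟_)
open import Relation.Nullary.Decidable using (_×-dec_; ¬?)
open import Data.Product using (Σ; _×_; ∃; ∃-syntax; _,_)
open import Data.List using (List; []; _∷_; length)
open import Data.List.Relation.Unary.Unique.Propositional using (Unique)
open import Data.Empty using (⊥)
open import Relation.Nullary using (¬_; Dec; yes; no)
open import Relation.Binary.PropositionalEquality using (_≡_; refl)
open import Relation.Unary using (Decidable)
open import Function.Definitions using (Injective)

record Graph (n : ℕ) : Set₁ where
  field
    Adj     : Fin n → Fin n → Set
    adj?    : ∀ u v → Dec (Adj u v)
    sym     : ∀ {u v} → Adj u v → Adj v u
    irrefl  : ∀ {u} → ¬ Adj u u

count : ∀ {m} {P : Fin m → Set} → Decidable P → ℕ
count {zero} P? = 0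
count {suc m} {P} P? with P? fzero
... | yes _ = suc (count {m} (λ i → P? (fsuc i)))
... | no  _ = count {m} (λ i → P? (fsuc i))

Σℕ : ∀ {m} → (Fin m → ℕ) → ℕ
Σℕ {zero} g = 0
Σℕ {suc m} g = g fzero + Σℕ (λ i → g (fsuc i))

module _ {n : ℕ} (G : Graph n) where
  open Graph G

  data Walk : Fin n → Fin n → Set where
    here : ∀ {u} → Walk u u
    step : ∀ {u w v} → Adj u w → Walk w v → Walk u v

  Connected : Set
  Connected = ∀ u v → Walk u v

  Cycle : Set
  Cycle = Σ ℕ λ k → 3 ≤ k × Σ (Fin k → Fin n) λ c →
            Injective _≡_ _≡_ c ×
            (∀ (i : Fin k) (i+1<k : suc (toℕ i) < k) → Adj (c i) (c (fromℕ< i+1<k))) ×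
            Σ (0 < k) λ 0<k → Σ (k ∸ 1 < k) λ last<k →
              Adj (c (fromℕ< last<k)) (c (fromℕ< 0<k))

  Acyclic : Set
  Acyclic = ¬ Cycle

  IsTree : Set
  IsTree = Connected × Acyclic

  ContainsPath : ℕ → Set
  ContainsPath s = Σ (Fin s → Fin n) λ p →
    Injective _≡_ _≡_ p ×
    (∀ (i : Fin s) (i+1<s : suc (toℕ i) < s) → Adj (p i) (p (fromℕ< i+1<s)))


  OrderedP4 : Fin n → Fin n → Fin n → Fin n → Set
  OrderedP4 a b c d = Adj a b × Adj b c × Adj c d ×
    ¬ a ≡ b × ¬ a ≡ c × ¬ a ≡ d × ¬ b ≡ c × ¬ b ≡ d × ¬ c ≡ d

  OrderedP4? : ∀ a b c d → Dec (OrderedP4 a b c d)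
  OrderedP4? a b c d =
    adj? a b ×-dec adj? b c ×-dec adj? c d ×-dec
    ¬? (a ≟ b) ×-dec ¬? (a ≟ c) ×-dec ¬? (a ≟ d) ×-dec
    ¬? (b ≟ c) ×-dec ¬? (b ≟ d) ×-dec ¬? (c ≟ d)

  #orderedP4 : ℕ
  #orderedP4 = Σℕ λ a → Σℕ λ b → Σℕ λ c → count (OrderedP4? a b c)

  -- Each (not necessarily induced) subgraph isomorphic to P₄ corresponds to
  -- exactly two ordered copies (a,b,c,d) and (d,c,b,a).
  #P4 : ℕ
  #P4 = #orderedP4 / 2

f : ℕ → ℕ → ℕ
f n s with 6 ≤? s
... | yes _ = (s ∸ 3) + 2 * (n ∸ s) + ⌊ n ∸ s /2⌋ * ⌈ n ∸ s /2⌉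
... | no  _ = ⌊ n ∸ 2 /2⌋ * ⌈ n ∸ 2 /2⌉

{-# OPTIONS --safe #-}
-- Root the tree T at the first vertex of the path. Breadth-first depth makes every edge a
-- parent-child edge, because a non-tree edge would close a cycle through the two ancestor
-- chains of its ends. In a tree the two middle vertices of a P₄ are determined by its ends, so
-- #orderedP4 equals the number N of ordered pairs (a, d) that are the ends of a P₄. Such a and d
-- lie in different classes of the depth-parity bipartition (sizes A and B) and are not adjacent,
-- so N + 2(n - 1) ≤ 2AB, whence N ≤ 2⌊(n-2)/2⌋⌈(n-2)/2⌉ since A + B = n. When s ≥ 6, split the
-- pairs by whether their ends lie on the path: two path vertices must be three apart along the
-- path (at most 2(s - 3) ordered pairs), a vertex off the path is paired with at most two path
-- vertices, and the pairs off the path are bounded by the bipartite count on n - s vertices.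
module Submission where

open import Data.Bool.Base using (if_then_else_)
open import Data.Empty using (⊥-elim)
open import Data.Fin.Base using (Fin; toℕ; fromℕ<; punchIn) renaming (zero to fzero; suc to fsuc)
open import Data.Fin.Properties
  using (_≟_; any?; toℕ<n; toℕ≤pred[n]; toℕ-injective; toℕ-fromℕ<; fromℕ<-toℕ; fromℕ<-cong; fromℕ<-injective; punchInᵢ≢i)
open import Data.Nat.Base
open import Data.Nat.DivMod using (/-monoˡ-≤; m*n/n≡m)
open import Data.Nat.Properties hiding (_≟_)
import Data.Nat.Properties as ℕ using (_≟_)
open import Algebra.Properties.Semiring.Sum +-*-semiring
  using (sum; sum-syntax; sum-cong-≗; sum-remove; sum-replicate-zero; ∑-comm; ∑-distrib-+; *-distribˡ-sum; *-distribʳ-sum)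
open import Data.Nat.Tactic.RingSolver using (solve-∀)
open import Data.Parity.Base using (Parity; 0ℙ; 1ℙ; _⁻¹)
open import Data.Parity.Properties using (⁻¹-selfInverse; ⁻¹-involutive; p≢p⁻¹; suc-homo-⁻¹)
import Data.Parity.Properties as ℙ using (_≟_)
open import Data.Product using (∃; _×_; _,_; proj₁; proj₂)
open import Data.Sum using (_⊎_; inj₁; inj₂; [_,_])
import Data.Sum as Sum using (map₂)
open import Data.Vec.Base using (Vec; _∷_; []; lookup; head; last)
open import Data.Vec.Relation.Unary.All using ([]; _∷_)
open import Data.Vec.Relation.Unary.AllPairs using ([]; _∷_)
open import Data.Vec.Relation.Unary.Linked using (Linked; _∷_; [-])
open import Data.Vec.Relation.Unary.Unique.Propositional using (Unique)
open import Data.Vec.Relation.Unary.Unique.Propositional.Properties using (lookup-injective)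
open import Function.Base using (_∘_)
open import Function.Definitions using (Injective)
open import Level using (Level)
open import Relation.Binary.Core using (Rel)
open import Relation.Binary.PropositionalEquality hiding ([_])
open import Relation.Nullary using (Dec; yes; no; does; ¬_; contradiction)
open import Relation.Nullary.Decidable using (_×-dec_; _⊎-dec_; ¬?)
open import Relation.Unary using (Decidable)

open import Defs

private
  variable
    ℓ ℓ′ ℓ″ : Level
    P : Set ℓ
    Q : Set ℓ′
    R : Set ℓ″

𝟙 : Dec P → ℕ
𝟙 P? = if does P? then 1 else 0

𝟙-yes : P → (P? : Dec P) → 𝟙 P? ≡ 1
𝟙-yes _ (yes _) = refl
𝟙-yes p (no ¬p) = contradiction p ¬p

𝟙-no : ¬ P → (P? : Dec P) → 𝟙 P? ≡ 0
𝟙-no ¬p (yes p) = contradiction p ¬p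
𝟙-no _  (no _)  = refl

𝟙≤1 : (P? : Dec P) → 𝟙 P? ≤ 1
𝟙≤1 (yes _) = ≤-refl
𝟙≤1 (no _)  = z≤n

𝟙-mono : (P → Q) → (P? : Dec P) (Q? : Dec Q) → 𝟙 P? ≤ 𝟙 Q?
𝟙-mono P⇒Q (yes p) Q? = ≤-reflexive (sym (𝟙-yes (P⇒Q p) Q?))
𝟙-mono P⇒Q (no _)  Q? = z≤n

𝟙-cong : (P → Q) → (Q → P) → (P? : Dec P) (Q? : Dec Q) → 𝟙 P? ≡ 𝟙 Q?
𝟙-cong P⇒Q Q⇒P P? Q? = ≤-antisym (𝟙-mono P⇒Q P? Q?) (𝟙-mono Q⇒P Q? P?)

𝟙-× : (P? : Dec P) (Q? : Dec Q) → 𝟙 (P? ×-dec Q?) ≡ 𝟙 P? * 𝟙 Q?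
𝟙-× (yes _) (yes _) = refl
𝟙-× (yes _) (no _)  = refl
𝟙-× (no _)  _       = refl

𝟙-⊎ : ¬ (P × Q) → (P? : Dec P) (Q? : Dec Q) → 𝟙 (P? ⊎-dec Q?) ≡ 𝟙 P? + 𝟙 Q?
𝟙-⊎ ¬both (yes p) (yes q) = contradiction (p , q) ¬both
𝟙-⊎ _     (yes _) (no _)  = refl
𝟙-⊎ _     (no _)  (yes _) = refl
𝟙-⊎ _     (no _)  (no _)  = refl

𝟙+𝟙¬ : (P? : Dec P) → 𝟙 P? + 𝟙 (¬? P?) ≡ 1
𝟙+𝟙¬ (yes _) = refl
𝟙+𝟙¬ (no _)  = refl

𝟙-mono-⊎ : (P → Q ⊎ R) → (P? : Dec P) (Q? : Dec Q) (R? : Dec R) → 𝟙 P? ≤ 𝟙 Q? + 𝟙 R?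
𝟙-mono-⊎ split (no _)  Q? R? = z≤n
𝟙-mono-⊎ split (yes p) Q? R? with split p
... | inj₁ q = ≤-trans (≤-reflexive (sym (𝟙-yes q Q?))) (m≤m+n _ _)
... | inj₂ r = ≤-trans (≤-reflexive (sym (𝟙-yes r R?))) (m≤n+m _ _)

Σℕ≡sum : ∀ {m} (f : Fin m → ℕ) → Σℕ f ≡ sum f
Σℕ≡sum {zero}  f = refl
Σℕ≡sum {suc m} f = cong (f fzero +_) (Σℕ≡sum (f ∘ fsuc))

count≡∑𝟙 : ∀ {m} {P : Fin m → Set} (P? : Decidable P) → count P? ≡ ∑[ i < m ] 𝟙 (P? i)
count≡∑𝟙 {zero}  P? = refl
count≡∑𝟙 {suc m} P? with P? fzero
... | yes _ = cong suc (count≡∑𝟙 (P? ∘ fsuc))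
... | no _  = count≡∑𝟙 (P? ∘ fsuc)

sum-mono-≤ : ∀ {m} {f g : Fin m → ℕ} → (∀ i → f i ≤ g i) → sum f ≤ sum g
sum-mono-≤ {zero}  f≤g = z≤n
sum-mono-≤ {suc m} f≤g = +-mono-≤ (f≤g fzero) (sum-mono-≤ (f≤g ∘ fsuc))

sum-const : ∀ m c → ∑[ i < m ] c ≡ m * c
sum-const zero    c = refl
sum-const (suc m) c = cong (c +_) (sum-const m c)

sum-zero : ∀ {m} {f : Fin m → ℕ} → (∀ i → f i ≡ 0) → sum f ≡ 0
sum-zero {m} f≡0 = trans (sum-cong-≗ f≡0) (sum-replicate-zero m)

sum-single : ∀ {m} {f : Fin m → ℕ} x → (∀ i → i ≢ x → f i ≡ 0) → sum f ≡ f x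
sum-single {suc m} {f} x f≡0 = begin
  sum f                                    ≡⟨ sum-remove {i = x} f ⟩
  f x + ∑[ j < m ] f (punchIn x j)         ≡⟨ cong (f x +_) (sum-zero (λ j → f≡0 _ (punchInᵢ≢i x j))) ⟩
  f x + 0                                  ≡⟨ +-identityʳ (f x) ⟩
  f x                                      ∎
  where open ≡-Reasoning

sum-*-sum : ∀ {m k} (f : Fin m → ℕ) (g : Fin k → ℕ) → ∑[ i < m ] ∑[ j < k ] (f i * g j) ≡ sum f * sum g
sum-*-sum f g = begin
  ∑[ i < _ ] ∑[ j < _ ] (f i * g j)  ≡⟨ sum-cong-≗ (λ i → sym (*-distribˡ-sum (f i) g)) ⟩
  ∑[ i < _ ] (f i * sum g)         ≡⟨ sym (*-distribʳ-sum (sum g) f) ⟩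
  sum f * sum g                    ∎
  where open ≡-Reasoning

∑𝟙≡𝟙∃ : ∀ {m} {P : Fin m → Set} (P? : Decidable P) → (∀ {i j} → P i → P j → i ≡ j) →
         ∑[ i < m ] 𝟙 (P? i) ≡ 𝟙 (any? P?)
∑𝟙≡𝟙∃ P? unique with any? P?
... | yes (x , px) = trans (sum-single x (λ i i≢x → 𝟙-no (λ pi → i≢x (unique pi px)) (P? i))) (𝟙-yes px (P? x))
... | no ∄         = sum-zero (λ i → 𝟙-no (λ pi → ∄ (i , pi)) (P? i))

∑𝟙≤1 : ∀ {m} {P : Fin m → Set} (P? : Decidable P) → (∀ {i j} → P i → P j → i ≡ j) → ∑[ i < m ] 𝟙 (P? i) ≤ 1
∑𝟙≤1 P? unique = ≤-trans (≤-reflexive (∑𝟙≡𝟙∃ P? unique)) (𝟙≤1 (any? P?))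

∑𝟙≟ : ∀ {m} (x : Fin m) → ∑[ i < m ] 𝟙 (i ≟ x) ≡ 1
∑𝟙≟ x = trans (sum-single x (λ i i≢x → 𝟙-no i≢x (i ≟ x))) (𝟙-yes refl (x ≟ x))

∑𝟙¬ : ∀ {m} {P : Fin m → Set} (P? : Decidable P) → ∑[ i < m ] 𝟙 (¬? (P? i)) ≡ m ∸ ∑[ i < m ] 𝟙 (P? i)
∑𝟙¬ {m} P? = sym (begin
  m ∸ ∑[ i < m ] 𝟙 (P? i)                                     ≡⟨ cong (_∸ ∑[ i < m ] 𝟙 (P? i)) m≡∑ ⟩
  ∑[ i < m ] 𝟙 (P? i) + ∑[ i < m ] 𝟙 (¬? (P? i)) ∸ ∑[ i < m ] 𝟙 (P? i)  ≡⟨ m+n∸m≡n (∑[ i < m ] 𝟙 (P? i)) _ ⟩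
  ∑[ i < m ] 𝟙 (¬? (P? i))                                    ∎)
  where
  open ≡-Reasoning
  m≡∑ : m ≡ ∑[ i < m ] 𝟙 (P? i) + ∑[ i < m ] 𝟙 (¬? (P? i))
  m≡∑ = sym (begin
    ∑[ i < m ] 𝟙 (P? i) + ∑[ i < m ] 𝟙 (¬? (P? i))   ≡⟨ sym (∑-distrib-+ {m} _ _) ⟩
    ∑[ i < m ] (𝟙 (P? i) + 𝟙 (¬? (P? i)))           ≡⟨ sum-cong-≗ {m} (λ i → 𝟙+𝟙¬ (P? i)) ⟩
    ∑[ i < m ] 1                                     ≡⟨ trans (sum-const m 1) (*-identityʳ m) ⟩
    m                                                ∎)

∑𝟙[+<]≤∸ : ∀ m k t → ∑[ i < m ] 𝟙 (toℕ i + k <? t) ≤ t ∸ k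
∑𝟙[+<]≤∸ zero    k t       = z≤n
∑𝟙[+<]≤∸ (suc m) k zero    =
  ≤-trans (≤-reflexive (sum-zero {suc m} {λ i → 𝟙 (toℕ i + k <? 0)} (λ i → 𝟙-no (λ ()) (toℕ i + k <? 0)))) z≤n
∑𝟙[+<]≤∸ (suc m) k (suc t) = begin
  𝟙 (k <? suc t) + ∑[ i < m ] 𝟙 (suc (toℕ i) + k <? suc t)
    ≡⟨ cong (𝟙 (k <? suc t) +_) (sum-cong-≗ {m} (λ i → 𝟙-cong s≤s⁻¹ s≤s (suc (toℕ i) + k <? suc t) (toℕ i + k <? t))) ⟩
  𝟙 (k <? suc t) + ∑[ i < m ] 𝟙 (toℕ i + k <? t)
    ≤⟨ +-monoʳ-≤ (𝟙 (k <? suc t)) (∑𝟙[+<]≤∸ m k t) ⟩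
  𝟙 (k <? suc t) + (t ∸ k)
    ≤⟨ add-first (k <? suc t) ⟩
  suc t ∸ k ∎
  where
  open ≤-Reasoning
  add-first : (k<1+t : Dec (k < suc t)) → 𝟙 k<1+t + (t ∸ k) ≤ suc t ∸ k
  add-first (yes k<1+t) = ≤-reflexive (sym (+-∸-assoc 1 (s≤s⁻¹ k<1+t)))
  add-first (no _)      = ∸-monoˡ-≤ k (n≤1+n t)

∑∑𝟙[≡+]≤∸ : ∀ m k → ∑[ i < m ] ∑[ j < m ] 𝟙 (toℕ j ℕ.≟ toℕ i + k) ≤ m ∸ k
∑∑𝟙[≡+]≤∸ m k = begin
  ∑[ i < m ] ∑[ j < m ] 𝟙 (toℕ j ℕ.≟ toℕ i + k)
    ≡⟨ sum-cong-≗ {m} (λ i → ∑𝟙≡𝟙∃ {m} (λ j → toℕ j ℕ.≟ toℕ i + k) (λ e e′ → toℕ-injective (trans e (sym e′)))) ⟩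
  ∑[ i < m ] 𝟙 (any? (λ (j : Fin m) → toℕ j ℕ.≟ toℕ i + k))
    ≤⟨ sum-mono-≤ {m} (λ i → 𝟙-mono (λ (j , e) → subst (_< m) e (toℕ<n j)) (any? (λ (j : Fin m) → toℕ j ℕ.≟ toℕ i + k)) (toℕ i + k <? m)) ⟩
  ∑[ i < m ] 𝟙 (toℕ i + k <? m)
    ≤⟨ ∑𝟙[+<]≤∸ m k m ⟩
  m ∸ k ∎
  where open ≤-Reasoning

leastWitness : ∀ {P : ℕ → Set ℓ} → (∀ k → Dec (P k)) → ∀ {k} → P k →
               ∃ λ m → P m × (∀ {j} → j < m → ¬ P j)
leastWitness P? {zero}  p = 0 , p , λ ()
leastWitness {P = P} P? {suc k} p with P? 0 | leastWitness (P? ∘ suc) p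
... | yes p₀ | _              = 0 , p₀ , λ ()
... | no ¬p₀ | m , pm , below = suc m , pm , below′
  where
  below′ : ∀ {j} → j < suc m → ¬ P j
  below′ {zero}  _       = ¬p₀
  below′ {suc j} 1+j<1+m = below (s<s⁻¹ 1+j<1+m)

halfProduct : ℕ → ℕ
halfProduct m = ⌊ m /2⌋ * ⌈ m /2⌉

m*n≤halfProduct[m+n] : ∀ m n → m * n ≤ halfProduct (m + n)
m*n≤halfProduct[m+n] zero    n       = z≤n
m*n≤halfProduct[m+n] (suc m) zero    = ≤-trans (≤-reflexive (*-zeroʳ m)) z≤n
m*n≤halfProduct[m+n] (suc m) (suc n) = begin
  suc m * suc n                                  ≡⟨ expand m n ⟩
  m * n + (m + n) + 1                            ≤⟨ +-monoˡ-≤ 1 (+-monoˡ-≤ (m + n) (m*n≤halfProduct[m+n] m n)) ⟩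
  halfProduct (m + n) + (m + n) + 1              ≡⟨ cong (λ k → halfProduct (m + n) + k + 1) (sym (⌊n/2⌋+⌈n/2⌉≡n (m + n))) ⟩
  halfProduct (m + n) + (⌊ m + n /2⌋ + ⌈ m + n /2⌉) + 1  ≡⟨ sym (expand ⌊ m + n /2⌋ ⌈ m + n /2⌉) ⟩
  halfProduct (2 + (m + n))                      ≡⟨ cong halfProduct (sym (+-suc (suc m) n)) ⟩
  halfProduct (suc m + suc n)                    ∎
  where
  open ≤-Reasoning
  expand : ∀ x y → suc x * suc y ≡ x * y + (x + y) + 1
  expand = solve-∀

m*n∸[m+n∸1]≤halfProduct[m+n∸2] : ∀ m n → m * n ∸ (m + n ∸ 1) ≤ halfProduct (m + n ∸ 2)
m*n∸[m+n∸1]≤halfProduct[m+n∸2] zero    n       = ≤-trans (≤-reflexive (0∸n≡0 (n ∸ 1))) z≤n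
m*n∸[m+n∸1]≤halfProduct[m+n∸2] (suc m) zero    = ≤-trans (m∸n≤m (m * 0) (m + 0)) (≤-trans (≤-reflexive (*-zeroʳ m)) z≤n)
m*n∸[m+n∸1]≤halfProduct[m+n∸2] (suc m) (suc n) = begin
  suc m * suc n ∸ (m + suc n)   ≡⟨ cong₂ _∸_ (expand m n) (+-suc m n) ⟩
  m * n + suc (m + n) ∸ suc (m + n)  ≡⟨ m+n∸n≡m (m * n) (suc (m + n)) ⟩
  m * n                          ≤⟨ m*n≤halfProduct[m+n] m n ⟩
  halfProduct (m + n)            ≡⟨ cong (halfProduct ∘ pred) (sym (+-suc m n)) ⟩
  halfProduct (m + suc n ∸ 1)    ∎
  where
  open ≤-Reasoning
  expand : ∀ x y → suc x * suc y ≡ x * y + suc (x + y)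
  expand = solve-∀

halve : ∀ {m k} → m ≤ 2 * k → m / 2 ≤ k
halve {m} {k} m≤2k = begin
  m / 2      ≤⟨ /-monoˡ-≤ 2 m≤2k ⟩
  2 * k / 2  ≡⟨ cong (_/ 2) (*-comm 2 k) ⟩
  k * 2 / 2  ≡⟨ m*n/n≡m k 2 ⟩
  k          ∎
  where open ≤-Reasoning

module _ {s n} {f : Fin s → Fin n} (f-injective : Injective _≡_ _≡_ f) where

  ∑-image : ∀ (g : Fin n → ℕ) → ∑[ a < n ] (𝟙 (any? (λ i → f i ≟ a)) * g a) ≡ ∑[ i < s ] g (f i)
  ∑-image g = begin
    ∑[ a < n ] (𝟙 (any? (λ i → f i ≟ a)) * g a)
      ≡⟨ sum-cong-≗ {n} (λ a → cong (_* g a) (sym (∑𝟙≡𝟙∃ (λ i → f i ≟ a) (λ e e′ → f-injective (trans e (sym e′)))))) ⟩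
    ∑[ a < n ] (∑[ i < s ] 𝟙 (f i ≟ a) * g a)
      ≡⟨ sum-cong-≗ {n} (λ a → *-distribʳ-sum (g a) (λ i → 𝟙 (f i ≟ a))) ⟩
    ∑[ a < n ] ∑[ i < s ] (𝟙 (f i ≟ a) * g a)
      ≡⟨ ∑-comm {n} {s} (λ a i → 𝟙 (f i ≟ a) * g a) ⟩
    ∑[ i < s ] ∑[ a < n ] (𝟙 (f i ≟ a) * g a)
      ≡⟨ sum-cong-≗ {s} (λ i → sum-single (f i) (λ a a≢fi → cong (_* g a) (𝟙-no (a≢fi ∘ sym) (f i ≟ a)))) ⟩
    ∑[ i < s ] (𝟙 (f i ≟ f i) * g (f i))
      ≡⟨ sum-cong-≗ {s} (λ i → trans (cong (_* g (f i)) (𝟙-yes refl (f i ≟ f i))) (*-identityˡ _)) ⟩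
    ∑[ i < s ] g (f i) ∎
    where open ≡-Reasoning

∑∑-distrib-+ : ∀ {m k} (f g : Fin m → Fin k → ℕ) →
               ∑[ a < m ] ∑[ d < k ] (f a d + g a d) ≡ ∑[ a < m ] ∑[ d < k ] f a d + ∑[ a < m ] ∑[ d < k ] g a d
∑∑-distrib-+ {m} {k} f g = trans (sum-cong-≗ {m} (λ a → ∑-distrib-+ {k} (f a) (g a))) (∑-distrib-+ {m} _ _)

pairSum : ∀ {n} → (Fin n → ℕ) → (Fin n → ℕ) → (Fin n → Fin n → ℕ) → ℕ
pairSum {n} x y e = ∑[ a < n ] ∑[ d < n ] (x a * y d * e a d)

module _ {n : ℕ} where

  pairSum-mono-≤ : ∀ x y {e e′ : Fin n → Fin n → ℕ} → (∀ a d → e a d ≤ e′ a d) → pairSum x y e ≤ pairSum x y e′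
  pairSum-mono-≤ x y e≤e′ = sum-mono-≤ {n} (λ a → sum-mono-≤ {n} (λ d → *-monoʳ-≤ (x a * y d) (e≤e′ a d)))

  pairSum-ones : ∀ e → pairSum {n} (λ _ → 1) (λ _ → 1) e ≡ ∑[ a < n ] ∑[ d < n ] e a d
  pairSum-ones e = sum-cong-≗ {n} (λ a → sum-cong-≗ {n} (λ d → +-identityʳ (e a d)))

  pairSum-swap : ∀ x y e → (∀ a d → e a d ≡ e d a) → pairSum {n} x y e ≡ pairSum y x e
  pairSum-swap x y e e-sym = trans (∑-comm {n} {n} _) (sum-cong-≗ {n} (λ d → sum-cong-≗ {n} (λ a →
    cong₂ _*_ (*-comm (x a) (y d)) (e-sym a d))))

  pairSum-nested : ∀ x y e → pairSum {n} x y e ≡ ∑[ a < n ] (x a * ∑[ d < n ] (y d * e a d))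
  pairSum-nested x y e = sum-cong-≗ {n} (λ a → begin
    ∑[ d < n ] (x a * y d * e a d)    ≡⟨ sum-cong-≗ {n} (λ d → *-assoc (x a) (y d) (e a d)) ⟩
    ∑[ d < n ] (x a * (y d * e a d))  ≡⟨ sym (*-distribˡ-sum (x a) (λ d → y d * e a d)) ⟩
    x a * ∑[ d < n ] (y d * e a d)    ∎)
    where open ≡-Reasoning

  pairSum-distribˡ : ∀ x x′ y e → pairSum {n} (λ a → x a + x′ a) y e ≡ pairSum x y e + pairSum x′ y e
  pairSum-distribˡ x x′ y e = trans
    (sum-cong-≗ {n} (λ a → sum-cong-≗ {n} (λ d → distrib (x a) (x′ a) (y d) (e a d))))
    (∑∑-distrib-+ {n} {n} _ _)
    where
    distrib : ∀ p q r t → (p + q) * r * t ≡ p * r * t + q * r * t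
    distrib = solve-∀

  pairSum-distribʳ : ∀ x y y′ e → pairSum {n} x (λ d → y d + y′ d) e ≡ pairSum x y e + pairSum x y′ e
  pairSum-distribʳ x y y′ e = trans
    (sum-cong-≗ {n} (λ a → sum-cong-≗ {n} (λ d → distrib (x a) (y d) (y′ d) (e a d))))
    (∑∑-distrib-+ {n} {n} _ _)
    where
    distrib : ∀ p q r t → p * (q + r) * t ≡ p * q * t + p * r * t
    distrib = solve-∀

  pairSum-split : ∀ x y e → (∀ a → x a + y a ≡ 1) →
                  ∑[ a < n ] ∑[ d < n ] e a d ≡ (pairSum x x e + pairSum x y e) + (pairSum y x e + pairSum y y e)
  pairSum-split x y e x+y≡1 = begin
    ∑[ a < n ] ∑[ d < n ] e a d                           ≡⟨ sym (pairSum-ones e) ⟩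
    pairSum (λ _ → 1) (λ _ → 1) e                         ≡⟨ sum-cong-≗ {n} (λ a → sum-cong-≗ {n} (λ d →
                                                               cong (λ t → t * e a d) (sym (cong₂ _*_ (x+y≡1 a) (x+y≡1 d))))) ⟩
    pairSum x+y x+y e                                     ≡⟨ pairSum-distribˡ x y x+y e ⟩
    pairSum x x+y e + pairSum y x+y e                     ≡⟨ cong₂ _+_ (pairSum-distribʳ x x y e) (pairSum-distribʳ y x y e) ⟩
    (pairSum x x e + pairSum x y e) + (pairSum y x e + pairSum y y e) ∎
    where
    open ≡-Reasoning
    x+y : Fin n → ℕ
    x+y a = x a + y a

module _ {n : ℕ} (colour : Fin n → Parity) where

  colourWeight : (Fin n → ℕ) → Parity → ℕ
  colourWeight w c = ∑[ a < n ] (w a * 𝟙 (colour a ℙ.≟ c))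

  colourWeight-sum : ∀ w → colourWeight w 0ℙ + colourWeight w 1ℙ ≡ sum w
  colourWeight-sum w = trans (sym (∑-distrib-+ {n} _ _)) (sum-cong-≗ {n} (λ a → split (w a) (colour a)))
    where
    split : ∀ k c → k * 𝟙 (c ℙ.≟ 0ℙ) + k * 𝟙 (c ℙ.≟ 1ℙ) ≡ k
    split k 0ℙ = trans (cong₂ _+_ (*-identityʳ k) (*-zeroʳ k)) (+-identityʳ k)
    split k 1ℙ = trans (cong₂ _+_ (*-zeroʳ k) (*-identityʳ k)) refl

  pairSum-bipartite : ∀ {R : Fin n → Fin n → Set} (R? : ∀ a d → Dec (R a d)) →
                      (∀ {a d} → R a d → colour a ≢ colour d) → ∀ w →
                      pairSum w w (λ a d → 𝟙 (R? a d)) ≤ 2 * (colourWeight w 0ℙ * colourWeight w 1ℙ)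
  pairSum-bipartite R? R⇒≢ w = begin
    pairSum w w (λ a d → 𝟙 (R? a d))
      ≤⟨ pairSum-mono-≤ w w crossing ⟩
    pairSum w w (λ a d → χ₀ a * χ₁ d + χ₁ a * χ₀ d)
      ≡⟨ sum-cong-≗ {n} (λ a → sum-cong-≗ {n} (λ d → regroup (w a) (w d) (χ₀ a) (χ₁ d) (χ₁ a) (χ₀ d))) ⟩
    ∑[ a < n ] ∑[ d < n ] ((w a * χ₀ a) * (w d * χ₁ d) + (w a * χ₁ a) * (w d * χ₀ d))
      ≡⟨ ∑∑-distrib-+ {n} {n} _ _ ⟩
    ∑[ a < n ] ∑[ d < n ] ((w a * χ₀ a) * (w d * χ₁ d)) + ∑[ a < n ] ∑[ d < n ] ((w a * χ₁ a) * (w d * χ₀ d))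
      ≡⟨ cong₂ _+_ (sum-*-sum {n} {n} _ _) (sum-*-sum {n} {n} _ _) ⟩
    W₀ * W₁ + W₁ * W₀
      ≡⟨ cong (W₀ * W₁ +_) (trans (*-comm W₁ W₀) (sym (+-identityʳ (W₀ * W₁)))) ⟩
    2 * (W₀ * W₁) ∎
    where
    open ≤-Reasoning
    χ₀ χ₁ : Fin n → ℕ
    χ₀ a = 𝟙 (colour a ℙ.≟ 0ℙ)
    χ₁ a = 𝟙 (colour a ℙ.≟ 1ℙ)
    W₀ W₁ : ℕ
    W₀ = colourWeight w 0ℙ
    W₁ = colourWeight w 1ℙ
    opposite : ∀ c c′ → c ≢ c′ → 1 ≤ 𝟙 (c ℙ.≟ 0ℙ) * 𝟙 (c′ ℙ.≟ 1ℙ) + 𝟙 (c ℙ.≟ 1ℙ) * 𝟙 (c′ ℙ.≟ 0ℙ)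
    opposite 0ℙ 0ℙ c≢c′ = contradiction refl c≢c′
    opposite 0ℙ 1ℙ _    = ≤-refl
    opposite 1ℙ 0ℙ _    = ≤-refl
    opposite 1ℙ 1ℙ c≢c′ = contradiction refl c≢c′
    crossing : ∀ a d → 𝟙 (R? a d) ≤ χ₀ a * χ₁ d + χ₁ a * χ₀ d
    crossing a d with R? a d
    ... | yes r = opposite (colour a) (colour d) (R⇒≢ r)
    ... | no _  = z≤n
    regroup : ∀ p q r t u v → p * q * (r * t + u * v) ≡ (p * r) * (q * t) + (p * u) * (q * v)
    regroup = solve-∀

  pairSum-bipartite-halfProduct : ∀ {R : Fin n → Fin n → Set} (R? : ∀ a d → Dec (R a d)) →
                                  (∀ {a d} → R a d → colour a ≢ colour d) → ∀ w →
                                  pairSum w w (λ a d → 𝟙 (R? a d)) ≤ 2 * halfProduct (sum w)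
  pairSum-bipartite-halfProduct R? R⇒≢ w = ≤-trans (pairSum-bipartite R? R⇒≢ w) (*-monoʳ-≤ 2
    (subst (λ k → colourWeight w 0ℙ * colourWeight w 1ℙ ≤ halfProduct k) (colourWeight-sum w)
           (m*n≤halfProduct[m+n] (colourWeight w 0ℙ) (colourWeight w 1ℙ))))

lookup-last : ∀ {a} {A : Set a} {k} (xs : Vec A (suc k)) → lookup xs (fromℕ< (n<1+n k)) ≡ last xs
lookup-last {k = zero}  (x ∷ []) = refl
lookup-last {k = suc k} (x ∷ xs) = lookup-last xs

Linked-lookup : ∀ {a r} {A : Set a} {R : Rel A r} {k} {xs : Vec A k} → Linked R xs →
                ∀ i (i+1<k : suc (toℕ i) < k) → R (lookup xs i) (lookup xs (fromℕ< i+1<k))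
Linked-lookup {xs = _ ∷ _ ∷ _} (Rxy ∷ _) fzero (s≤s (s≤s z≤n)) = Rxy
Linked-lookup (_ ∷ Rxs) (fsuc i) (s≤s i+1<k) = Linked-lookup Rxs i i+1<k

module _ {n} (G : Graph n) where
  open Graph G renaming (sym to Adj-sym)

  cycle-fromVec : ∀ {k} (xs : Vec (Fin n) (3 + k)) → Unique xs → Linked Adj xs → Adj (last xs) (head xs) → Cycle G
  cycle-fromVec {k} xs@(_ ∷ _) xs! xs-linked closing =
    3 + k , s≤s (s≤s (s≤s z≤n)) , lookup xs , lookup-injective xs! _ _ , Linked-lookup xs-linked ,
    s≤s z≤n , n<1+n (2 + k) , subst (λ x → Adj x (head xs)) (sym (lookup-last xs)) closing

  cycle-tabulate : ∀ k (g : ℕ → Fin n) → 2 ≤ k → (∀ {i j} → i ≤ k → j ≤ k → g i ≡ g j → i ≡ j) →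
                   (∀ {i} → i < k → Adj (g i) (g (suc i))) → Adj (g k) (g 0) → Cycle G
  cycle-tabulate k g 2≤k g-inj g-adj closing =
    suc k , s≤s 2≤k , g ∘ toℕ ,
    (λ {i} {j} e → toℕ-injective (g-inj (toℕ≤pred[n] i) (toℕ≤pred[n] j) e)) ,
    (λ i i+1<k → subst (λ j → Adj (g (toℕ i)) (g j)) (sym (toℕ-fromℕ< i+1<k)) (g-adj (s≤s⁻¹ i+1<k))) ,
    s≤s z≤n , n<1+n k ,
    subst₂ (λ x y → Adj (g x) (g y)) (sym (toℕ-fromℕ< (n<1+n k))) refl closing

  P4Ends : Fin n → Fin n → Set
  P4Ends a d = ∃ λ b → ∃ λ c → OrderedP4 G a b c d

  p4Ends? : ∀ a d → Dec (P4Ends a d)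
  p4Ends? a d = any? λ b → any? λ c → OrderedP4? G a b c d

  #P4Ends : ℕ
  #P4Ends = ∑[ a < n ] ∑[ d < n ] 𝟙 (p4Ends? a d)

  OrderedP4-reverse : ∀ {a b c d} → OrderedP4 G a b c d → OrderedP4 G d c b a
  OrderedP4-reverse (ab , bc , cd , a≢b , a≢c , a≢d , b≢c , b≢d , c≢d) =
    Adj-sym cd , Adj-sym bc , Adj-sym ab , c≢d ∘ sym , b≢d ∘ sym , a≢d ∘ sym , b≢c ∘ sym , a≢c ∘ sym , a≢b ∘ sym

  P4Ends-sym : ∀ {a d} → P4Ends a d → P4Ends d a
  P4Ends-sym (b , c , abcd) = c , b , OrderedP4-reverse abcd

  module _ (acyclic : Acyclic G) where

    OrderedP4⇒¬Adj : ∀ {a b c d} → OrderedP4 G a b c d → ¬ Adj a d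
    OrderedP4⇒¬Adj {a} {b} {c} {d} (ab , bc , cd , a≢b , a≢c , a≢d , b≢c , b≢d , c≢d) ad =
      acyclic (cycle-fromVec (a ∷ b ∷ c ∷ d ∷ [])
        ((a≢b ∷ a≢c ∷ a≢d ∷ []) ∷ (b≢c ∷ b≢d ∷ []) ∷ (c≢d ∷ []) ∷ [] ∷ [])
        (ab ∷ bc ∷ cd ∷ [-]) (Adj-sym ad))

    OrderedP4-middle-unique : ∀ {a b c d b′ c′} → OrderedP4 G a b c d → OrderedP4 G a b′ c′ d → b ≡ b′ × c ≡ c′
    OrderedP4-middle-unique {a} {b} {c} {d} {b′} {c′}
      (ab , bc , cd , a≢b , a≢c , a≢d , b≢c , b≢d , c≢d) (ab′ , b′c′ , c′d , a≢b′ , a≢c′ , _ , b′≢c′ , b′≢d , c′≢d)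
      with b ≟ b′ | c ≟ c′
    ... | yes b≡b′ | yes c≡c′ = b≡b′ , c≡c′
    ... | yes refl | no c≢c′ = ⊥-elim (acyclic (cycle-fromVec (b ∷ c ∷ d ∷ c′ ∷ [])
        ((b≢c ∷ b≢d ∷ b′≢c′ ∷ []) ∷ (c≢d ∷ c≢c′ ∷ []) ∷ ((c′≢d ∘ sym) ∷ []) ∷ [] ∷ [])
        (bc ∷ cd ∷ Adj-sym c′d ∷ [-]) (Adj-sym b′c′)))
    ... | no b≢b′ | yes refl = ⊥-elim (acyclic (cycle-fromVec (a ∷ b ∷ c ∷ b′ ∷ [])
        ((a≢b ∷ a≢c ∷ a≢b′ ∷ []) ∷ (b≢c ∷ b≢b′ ∷ []) ∷ ((b′≢c′ ∘ sym) ∷ []) ∷ [] ∷ [])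
        (ab ∷ bc ∷ Adj-sym b′c′ ∷ [-]) (Adj-sym ab′)))
    ... | no b≢b′ | no c≢c′ with b ≟ c′ | c ≟ b′
    ...   | yes refl | _ = ⊥-elim (acyclic (cycle-fromVec (a ∷ b ∷ b′ ∷ [])
        ((a≢b ∷ a≢b′ ∷ []) ∷ (b≢b′ ∷ []) ∷ [] ∷ [])
        (ab ∷ Adj-sym b′c′ ∷ [-]) (Adj-sym ab′)))
    ...   | no _ | yes refl = ⊥-elim (acyclic (cycle-fromVec (c ∷ d ∷ c′ ∷ [])
        ((c≢d ∷ c≢c′ ∷ []) ∷ ((c′≢d ∘ sym) ∷ []) ∷ [] ∷ [])
        (cd ∷ Adj-sym c′d ∷ [-]) (Adj-sym b′c′)))
    ...   | no b≢c′ | no c≢b′ = ⊥-elim (acyclic (cycle-fromVec (a ∷ b ∷ c ∷ d ∷ c′ ∷ b′ ∷ [])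
        ((a≢b ∷ a≢c ∷ a≢d ∷ a≢c′ ∷ a≢b′ ∷ []) ∷ (b≢c ∷ b≢d ∷ b≢c′ ∷ b≢b′ ∷ []) ∷ (c≢d ∷ c≢c′ ∷ c≢b′ ∷ []) ∷
         ((c′≢d ∘ sym) ∷ (b′≢d ∘ sym) ∷ []) ∷ ((b′≢c′ ∘ sym) ∷ []) ∷ [] ∷ [])
        (ab ∷ bc ∷ cd ∷ Adj-sym c′d ∷ Adj-sym b′c′ ∷ [-]) (Adj-sym ab′)))

    #orderedP4≡#P4Ends : #orderedP4 G ≡ #P4Ends
    #orderedP4≡#P4Ends = begin
      #orderedP4 G
        ≡⟨ trans (Σℕ≡sum {n} _) (sum-cong-≗ {n} λ a → trans (Σℕ≡sum {n} _) (sum-cong-≗ {n} λ b →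
             trans (Σℕ≡sum {n} _) (sum-cong-≗ {n} λ c → count≡∑𝟙 (OrderedP4? G a b c)))) ⟩
      ∑[ a < n ] ∑[ b < n ] ∑[ c < n ] ∑[ d < n ] 𝟙 (OrderedP4? G a b c d)
        ≡⟨ sum-cong-≗ {n} (λ a → trans (sum-cong-≗ {n} λ b → ∑-comm {n} {n} (λ c d → 𝟙 (OrderedP4? G a b c d)))
                                        (∑-comm {n} {n} _)) ⟩
      ∑[ a < n ] ∑[ d < n ] ∑[ b < n ] ∑[ c < n ] 𝟙 (OrderedP4? G a b c d)
        ≡⟨ sum-cong-≗ {n} (λ a → sum-cong-≗ {n} λ d → sum-cong-≗ {n} λ b →
             ∑𝟙≡𝟙∃ (λ c → OrderedP4? G a b c d) (λ abcd abc′d → proj₂ (OrderedP4-middle-unique abcd abc′d))) ⟩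
      ∑[ a < n ] ∑[ d < n ] ∑[ b < n ] 𝟙 (any? λ c → OrderedP4? G a b c d)
        ≡⟨ sum-cong-≗ {n} (λ a → sum-cong-≗ {n} λ d →
             ∑𝟙≡𝟙∃ (λ b → any? λ c → OrderedP4? G a b c d)
                   (λ (_ , abcd) (_ , ab′c′d) → proj₁ (OrderedP4-middle-unique abcd ab′c′d))) ⟩
      #P4Ends ∎
      where open ≡-Reasoning

m∸n≡1+[m∸1+n] : ∀ {m n} → n < m → m ∸ n ≡ suc (m ∸ suc n)
m∸n≡1+[m∸1+n] {suc m} {zero}  _         = refl
m∸n≡1+[m∸1+n] {suc m} {suc n} (s≤s n<m) = m∸n≡1+[m∸1+n] n<m

module Rooted {n} (G : Graph n) (connected : Connected G) (root : Fin n) where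
  open Graph G renaming (sym to Adj-sym)

  WithinSteps : ℕ → Fin n → Set
  WithinSteps zero    v = v ≡ root
  WithinSteps (suc k) v = WithinSteps k v ⊎ ∃ λ u → WithinSteps k u × Adj u v

  withinSteps? : ∀ k v → Dec (WithinSteps k v)
  withinSteps? zero    v = v ≟ root
  withinSteps? (suc k) v = withinSteps? k v ⊎-dec any? (λ u → withinSteps? k u ×-dec adj? u v)

  walk⇒withinSteps : ∀ {k u v} → WithinSteps k u → Walk G u v → ∃ λ k′ → WithinSteps k′ v
  walk⇒withinSteps u∈k here          = _ , u∈k
  walk⇒withinSteps u∈k (step uw w→v) = walk⇒withinSteps (inj₂ (_ , u∈k , uw)) w→v

  opaque
    distance : ∀ v → ∃ λ m → WithinSteps m v × (∀ {j} → j < m → ¬ WithinSteps j v)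
    distance v = leastWitness (λ k → withinSteps? k v) (proj₂ (walk⇒withinSteps {0} refl (connected root v)))

  depth : Fin n → ℕ
  depth v = proj₁ (distance v)

  depth-withinSteps : ∀ v → WithinSteps (depth v) v
  depth-withinSteps v = proj₁ (proj₂ (distance v))

  depth-≤ : ∀ {v j} → WithinSteps j v → depth v ≤ j
  depth-≤ {v} v∈j = ≮⇒≥ (λ j<depth → proj₂ (proj₂ (distance v)) j<depth v∈j)

  depth-root : depth root ≡ 0
  depth-root = n≤0⇒n≡0 (depth-≤ refl)

  depth≡0⇒root : ∀ {v} → depth v ≡ 0 → v ≡ root
  depth≡0⇒root {v} depth≡0 = subst (λ k → WithinSteps k v) depth≡0 (depth-withinSteps v)

  depth-adj : ∀ {u v} → Adj u v → depth v ≤ suc (depth u)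
  depth-adj {u} uv = depth-≤ (inj₂ (u , depth-withinSteps u , uv))

  parentStep : ∀ v → v ≢ root → ∃ λ u → WithinSteps (pred (depth v)) u × Adj u v
  parentStep v v≢root with depth v | depth-withinSteps v | proj₂ (proj₂ (distance v))
  ... | zero  | v≡root          | _     = contradiction v≡root v≢root
  ... | suc k | inj₁ v∈k        | least = contradiction v∈k (least (n<1+n k))
  ... | suc k | inj₂ (u , u∈k , uv) | _ = u , u∈k , uv

  parent : Fin n → Fin n
  parent v with v ≟ root
  ... | yes _      = root
  ... | no v≢root  = proj₁ (parentStep v v≢root)

  parent-root : parent root ≡ root
  parent-root with root ≟ root
  ... | yes _       = refl
  ... | no root≢root = contradiction refl root≢root

  parent-adj : ∀ {v} → v ≢ root → Adj (parent v) v
  parent-adj {v} v≢root with v ≟ root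
  ... | yes v≡root = contradiction v≡root v≢root
  ... | no v≢root′ = proj₂ (proj₂ (parentStep v v≢root′))

  depth-parent : ∀ {v} → v ≢ root → suc (depth (parent v)) ≡ depth v
  depth-parent {v} v≢root with v ≟ root
  ... | yes v≡root = contradiction v≡root v≢root
  ... | no v≢root′ with parentStep v v≢root′
  ...   | u , u∈ , uv = ≤-antisym
          (≤-trans (s≤s (depth-≤ u∈)) (≤-reflexive (suc-pred (depth v) {{≢-nonZero (v≢root ∘ depth≡0⇒root)}})))
          (depth-adj uv)

  Child : Fin n → Fin n → Set
  Child x c = c ≢ root × parent c ≡ x

  child? : ∀ x c → Dec (Child x c)
  child? x c = ¬? (c ≟ root) ×-dec (parent c ≟ x)

  child-adj : ∀ {x c} → Child x c → Adj x c
  child-adj (c≢root , refl) = parent-adj c≢root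

  child-depth : ∀ {x c} → Child x c → depth c ≡ suc (depth x)
  child-depth (c≢root , refl) = sym (depth-parent c≢root)

  child-asym : ∀ {x c} → Child x c → ¬ Child c x
  child-asym {x} {c} x→c c→x = <-irrefl refl (begin-strict
    depth c           <⟨ n<1+n (depth c) ⟩
    suc (depth c)     ≡⟨ sym (child-depth c→x) ⟩
    depth x           <⟨ n<1+n (depth x) ⟩
    suc (depth x)     ≡⟨ sym (child-depth x→c) ⟩
    depth c           ∎)
    where open ≤-Reasoning

  depth-great-grandchild : ∀ {a b c d} → Child a b → Child b c → Child c d → depth d ≡ depth a + 3
  depth-great-grandchild {a} {b} {c} {d} a→b b→c c→d = begin
    depth d              ≡⟨ child-depth c→d ⟩
    suc (depth c)        ≡⟨ cong suc (child-depth b→c) ⟩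
    2+ (depth b)         ≡⟨ cong 2+ (child-depth a→b) ⟩
    3 + depth a          ≡⟨ +-comm 3 (depth a) ⟩
    depth a + 3          ∎
    where open ≡-Reasoning

  ∑𝟙child≡𝟙≢root : ∀ c → ∑[ x < n ] 𝟙 (child? x c) ≡ 𝟙 (¬? (c ≟ root))
  ∑𝟙child≡𝟙≢root c =
    trans (sum-single (parent c) (λ x x≢pc → 𝟙-no (λ (_ , pc≡x) → x≢pc (sym pc≡x)) (child? x c)))
          (𝟙-cong proj₁ (_, refl) (child? (parent c) c) (¬? (c ≟ root)))

  2[n∸1]≤∑∑𝟙adj : 2 * (n ∸ 1) ≤ ∑[ a < n ] ∑[ d < n ] 𝟙 (adj? a d)
  2[n∸1]≤∑∑𝟙adj = begin
    2 * (n ∸ 1)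
      ≡⟨ cong (n ∸ 1 +_) (+-identityʳ (n ∸ 1)) ⟩
    (n ∸ 1) + (n ∸ 1)
      ≡⟨ sym (cong₂ _+_ non-roots non-roots) ⟩
    ∑[ d < n ] 𝟙 (¬? (d ≟ root)) + ∑[ a < n ] 𝟙 (¬? (a ≟ root))
      ≡⟨ sym (cong₂ _+_ (trans (∑-comm {n} {n} (λ a d → 𝟙 (child? a d))) (sum-cong-≗ {n} ∑𝟙child≡𝟙≢root))
                        (sum-cong-≗ {n} ∑𝟙child≡𝟙≢root)) ⟩
    ∑[ a < n ] ∑[ d < n ] 𝟙 (child? a d) + ∑[ a < n ] ∑[ d < n ] 𝟙 (child? d a)
      ≡⟨ sym (∑∑-distrib-+ {n} {n} _ _) ⟩
    ∑[ a < n ] ∑[ d < n ] (𝟙 (child? a d) + 𝟙 (child? d a))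
      ≤⟨ sum-mono-≤ {n} (λ a → sum-mono-≤ {n} (λ d → parent-edge≤adj a d)) ⟩
    ∑[ a < n ] ∑[ d < n ] 𝟙 (adj? a d) ∎
    where
    open ≤-Reasoning
    non-roots : ∑[ v < n ] 𝟙 (¬? (v ≟ root)) ≡ n ∸ 1
    non-roots = trans (∑𝟙¬ (_≟ root)) (cong (n ∸_) (∑𝟙≟ root))
    parent-edge≤adj : ∀ a d → 𝟙 (child? a d) + 𝟙 (child? d a) ≤ 𝟙 (adj? a d)
    parent-edge≤adj a d = begin
      𝟙 (child? a d) + 𝟙 (child? d a)
        ≡⟨ sym (𝟙-⊎ (λ (a→d , d→a) → child-asym a→d d→a) (child? a d) (child? d a)) ⟩
      𝟙 (child? a d ⊎-dec child? d a)
        ≤⟨ 𝟙-mono [ child-adj , Adj-sym ∘ child-adj ] (child? a d ⊎-dec child? d a) (adj? a d) ⟩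
      𝟙 (adj? a d) ∎

  ancestor : ℕ → Fin n → Fin n
  ancestor zero    v = v
  ancestor (suc j) v = parent (ancestor j v)

  depth-parent-pred : ∀ v → depth (parent v) ≡ pred (depth v)
  depth-parent-pred v = by-cases (v ≟ root)
    where
    by-cases : Dec (v ≡ root) → depth (parent v) ≡ pred (depth v)
    by-cases (yes refl)    = trans (cong depth parent-root) (trans depth-root (cong pred (sym depth-root)))
    by-cases (no v≢root) = cong pred (depth-parent v≢root)

  depth-ancestor : ∀ j v → depth (ancestor j v) ≡ depth v ∸ j
  depth-ancestor zero    v = refl
  depth-ancestor (suc j) v = begin
    depth (parent (ancestor j v))  ≡⟨ depth-parent-pred (ancestor j v) ⟩
    pred (depth (ancestor j v))    ≡⟨ cong pred (depth-ancestor j v) ⟩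
    pred (depth v ∸ j)             ≡⟨ pred[m∸n]≡m∸[1+n] (depth v) j ⟩
    depth v ∸ suc j                ∎
    where open ≡-Reasoning

  ancestor-injective : ∀ {i j v} → i ≤ depth v → j ≤ depth v → ancestor i v ≡ ancestor j v → i ≡ j
  ancestor-injective {i} {j} {v} i≤ j≤ e =
    ∸-cancelˡ-≡ i≤ j≤ (trans (sym (depth-ancestor i v)) (trans (cong depth e) (depth-ancestor j v)))

  ancestor-≢root : ∀ {j v} → j < depth v → ancestor j v ≢ root
  ancestor-≢root {j} {v} j<depth a≡root =
    m>n⇒m∸n≢0 j<depth (trans (sym (depth-ancestor j v)) (trans (cong depth a≡root) depth-root))

  ancestor-root : ∀ {j v} → depth v ≤ j → ancestor j v ≡ root
  ancestor-root {j} {v} depth≤j = depth≡0⇒root (trans (depth-ancestor j v) (m≤n⇒m∸n≡0 depth≤j))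

  ancestorsCycle : ∀ {u v} α β → 1 ≤ α → 1 ≤ β → α ≤ depth u → β ≤ depth v → ancestor α u ≡ ancestor β v →
                   (∀ {i j} → i ≤ α → j < β → ancestor i u ≢ ancestor j v) → Adj v u → Cycle G
  ancestorsCycle {u} {v} α β 1≤α 1≤β α≤du β≤dv meet disjoint vu =
    cycle-tabulate G (α + β) walk (+-mono-≤ 1≤α 1≤β) walk-injective walk-adj closing
    where
    walk : ℕ → Fin n
    walk i with i ≤? α
    ... | yes _ = ancestor i u
    ... | no _  = ancestor (α + β ∸ i) v

    walk-low : ∀ {i} → i ≤ α → walk i ≡ ancestor i u
    walk-low {i} i≤α with i ≤? α
    ... | yes _  = refl
    ... | no i≰α = contradiction i≤α i≰α

    walk-high : ∀ {i} → α ≤ i → walk i ≡ ancestor (α + β ∸ i) v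
    walk-high {i} α≤i with i ≤? α
    ... | yes i≤α = begin
      ancestor i u              ≡⟨ cong (λ k → ancestor k u) (≤-antisym i≤α α≤i) ⟩
      ancestor α u              ≡⟨ meet ⟩
      ancestor β v              ≡⟨ cong (λ k → ancestor k v) (sym (m+n∸m≡n α β)) ⟩
      ancestor (α + β ∸ α) v    ≡⟨ cong (λ k → ancestor (α + β ∸ k) v) (≤-antisym α≤i i≤α) ⟩
      ancestor (α + β ∸ i) v    ∎
      where open ≡-Reasoning
    ... | no _ = refl

    high-index< : ∀ {i} → α < i → i ≤ α + β → α + β ∸ i < β
    high-index< {i} α<i i≤α+β = ≤-trans (∸-monoʳ-< α<i i≤α+β) (≤-reflexive (m+n∸m≡n α β))

    walk-injective : ∀ {i j} → i ≤ α + β → j ≤ α + β → walk i ≡ walk j → i ≡ j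
    walk-injective {i} {j} i≤ j≤ e = by-cases (i ≤? α) (j ≤? α)
      where
      by-cases : Dec (i ≤ α) → Dec (j ≤ α) → i ≡ j
      by-cases (yes i≤α) (yes j≤α) = ancestor-injective (≤-trans i≤α α≤du) (≤-trans j≤α α≤du)
                                (trans (sym (walk-low i≤α)) (trans e (walk-low j≤α)))
      by-cases (yes i≤α) (no j≰α)  = contradiction (trans (sym (walk-low i≤α)) (trans e (walk-high (<⇒≤ (≰⇒> j≰α)))))
                                (disjoint i≤α (high-index< (≰⇒> j≰α) j≤))
      by-cases (no i≰α)  (yes j≤α) = contradiction (trans (sym (walk-low j≤α)) (trans (sym e) (walk-high (<⇒≤ (≰⇒> i≰α)))))
                                (disjoint j≤α (high-index< (≰⇒> i≰α) i≤))
      by-cases (no i≰α)  (no j≰α)  = ∸-cancelˡ-≡ i≤ j≤ (ancestor-injective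
                                (≤-trans (<⇒≤ (high-index< (≰⇒> i≰α) i≤)) β≤dv)
                                (≤-trans (<⇒≤ (high-index< (≰⇒> j≰α) j≤)) β≤dv)
                                (trans (sym (walk-high (<⇒≤ (≰⇒> i≰α)))) (trans e (walk-high (<⇒≤ (≰⇒> j≰α))))))

    walk-adj : ∀ {i} → i < α + β → Adj (walk i) (walk (suc i))
    walk-adj {i} i<α+β = by-cases (suc i ≤? α)
      where
      by-cases : Dec (suc i ≤ α) → Adj (walk i) (walk (suc i))
      by-cases (yes i<α) = subst₂ Adj (sym (walk-low (<⇒≤ i<α))) (sym (walk-low i<α))
                      (Adj-sym (parent-adj (ancestor-≢root (<-≤-trans i<α α≤du))))
      by-cases (no i≮α)  = subst₂ Adj
                      (sym (trans (walk-high (≮⇒≥ i≮α)) (cong (λ k → ancestor k v) (m∸n≡1+[m∸1+n] i<α+β))))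
                      (sym (walk-high (<⇒≤ (≰⇒> i≮α))))
                      (parent-adj (ancestor-≢root (<-≤-trans (high-index< (≰⇒> i≮α) i<α+β) β≤dv)))

    closing : Adj (walk (α + β)) (walk 0)
    closing = subst₂ Adj
      (sym (trans (walk-high (m≤m+n α β)) (cong (λ k → ancestor k v) (n∸n≡0 (α + β)))))
      (sym (walk-low z≤n))
      vu

  nonParentEdge⇒Cycle : ∀ {u v} → Adj u v → depth u ≤ depth v → u ≢ parent v → Cycle G
  nonParentEdge⇒Cycle {u} {v} uv du≤dv u≢pv =
    ancestorsCycle α (α + δ) 1≤α (≤-trans 1≤α (m≤m+n α δ)) α≤du α+δ≤dv meetα disjoint (Adj-sym uv)
    where
    δ : ℕ
    δ = depth v ∸ depth u

    du+δ≡dv : depth u + δ ≡ depth v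
    du+δ≡dv = m+[n∸m]≡n du≤dv

    -- The ancestor chains of u and v, the latter shifted by δ ∈ {0, 1}, first meet at height α.
    Meet : ℕ → Set
    Meet i = ancestor i u ≡ ancestor (i + δ) v

    meet-at-root : Meet (depth u)
    meet-at-root = trans (ancestor-root ≤-refl) (sym (ancestor-root (≤-reflexive (sym du+δ≡dv))))

    least : ∃ λ α → Meet α × (∀ {i} → i < α → ¬ Meet i)
    least = leastWitness (λ i → ancestor i u ≟ ancestor (i + δ) v) {depth u} meet-at-root

    α : ℕ
    α = proj₁ least

    meetα : Meet α
    meetα = proj₁ (proj₂ least)

    below-α : ∀ {i} → i < α → ¬ Meet i
    below-α = proj₂ (proj₂ least)

    α≤du : α ≤ depth u
    α≤du = ≮⇒≥ (λ du<α → below-α du<α meet-at-root)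

    α+δ≤dv : α + δ ≤ depth v
    α+δ≤dv = ≤-trans (+-monoˡ-≤ δ α≤du) (≤-reflexive du+δ≡dv)

    1≤α : 1 ≤ α
    1≤α = n≢0⇒n>0 α≢0
      where
      δ≤1 : δ ≤ 1
      δ≤1 = ≤-trans (∸-monoˡ-≤ (depth u) (depth-adj uv)) (≤-reflexive (m+n∸n≡m 1 (depth u)))
      not-adjacent-by : ∀ k → k ≤ 1 → u ≢ ancestor k v
      not-adjacent-by 0       _ u≡v  = irrefl (subst (Adj u) (sym u≡v) uv)
      not-adjacent-by 1       _ u≡pv = u≢pv u≡pv
      not-adjacent-by (2+ _)  (s≤s ())
      α≢0 : α ≢ 0
      α≢0 α≡0 = not-adjacent-by δ δ≤1 (subst Meet α≡0 meetα)

    disjoint : ∀ {i j} → i ≤ α → j < α + δ → ancestor i u ≢ ancestor j v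
    disjoint {i} {j} i≤α j<α+δ e = below-α i<α (subst (λ k → ancestor i u ≡ ancestor k v) j≡i+δ e)
      where
      t : ℕ
      t = depth (ancestor i u)
      t+i≡du : t + i ≡ depth u
      t+i≡du = trans (cong (_+ i) (depth-ancestor i u)) (m∸n+n≡m (≤-trans i≤α α≤du))
      t+j≡dv : t + j ≡ depth v
      t+j≡dv = trans (cong (λ x → depth x + j) e)
                     (trans (cong (_+ j) (depth-ancestor j v)) (m∸n+n≡m (≤-trans (<⇒≤ j<α+δ) α+δ≤dv)))
      j≡i+δ : j ≡ i + δ
      j≡i+δ = +-cancelˡ-≡ t j (i + δ) (begin
        t + j          ≡⟨ t+j≡dv ⟩
        depth v        ≡⟨ sym du+δ≡dv ⟩
        depth u + δ    ≡⟨ cong (_+ δ) (sym t+i≡du) ⟩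
        t + i + δ      ≡⟨ +-assoc t i δ ⟩
        t + (i + δ)    ∎)
        where open ≡-Reasoning
      i<α : i < α
      i<α = +-cancelʳ-< δ i α (subst (_< α + δ) j≡i+δ j<α+δ)

  module Tree (acyclic : Acyclic G) where

    edge-parent : ∀ {u v} → Adj u v → Child u v ⊎ Child v u
    edge-parent {u} {v} uv with u ≟ parent v | v ≟ parent u
    ... | yes u≡pv | _ = inj₁ (v≢root , sym u≡pv)
      where
      v≢root : v ≢ root
      v≢root refl = irrefl (subst (λ x → Adj x root) (trans u≡pv parent-root) uv)
    ... | no _ | yes v≡pu = inj₂ (u≢root , sym v≡pu)
      where
      u≢root : u ≢ root
      u≢root refl = irrefl (subst (Adj root) (trans v≡pu parent-root) uv)
    ... | no u≢pv | no v≢pu with ≤-total (depth u) (depth v)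
    ...   | inj₁ du≤dv = ⊥-elim (acyclic (nonParentEdge⇒Cycle uv du≤dv u≢pv))
    ...   | inj₂ dv≤du = ⊥-elim (acyclic (nonParentEdge⇒Cycle (Adj-sym uv) dv≤du v≢pu))

    parent-unique : ∀ {x y c} → Child x c → Child y c → x ≡ y
    parent-unique (_ , pc≡x) (_ , pc≡y) = trans (sym pc≡x) pc≡y

    -- ↑ is a step to the parent, ↓ a step to a child; a step ↓ followed by ↑ would return to the same vertex.
    data Shape (a b c d : Fin n) : Set where
      ↑↑↑ : Child b a → Child c b → Child d c → Shape a b c d
      ↑↑↓ : Child b a → Child c b → Child c d → Shape a b c d
      ↑↓↓ : Child b a → Child b c → Child c d → Shape a b c d
      ↓↓↓ : Child a b → Child b c → Child c d → Shape a b c d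

    shape : ∀ {a b c d} → OrderedP4 G a b c d → Shape a b c d
    shape (ab , bc , cd , _ , a≢c , _ , _ , b≢d , _) with edge-parent ab | edge-parent bc | edge-parent cd
    ... | inj₂ b→a | inj₂ c→b | inj₂ d→c = ↑↑↑ b→a c→b d→c
    ... | inj₂ b→a | inj₂ c→b | inj₁ c→d = ↑↑↓ b→a c→b c→d
    ... | inj₂ b→a | inj₁ b→c | inj₁ c→d = ↑↓↓ b→a b→c c→d
    ... | inj₁ a→b | inj₁ b→c | inj₁ c→d = ↓↓↓ a→b b→c c→d
    ... | _        | inj₁ b→c | inj₂ d→c = contradiction (parent-unique b→c d→c) b≢d
    ... | inj₁ a→b | inj₂ c→b | _        = contradiction (parent-unique a→b c→b) a≢c

    colour : Fin n → Parity
    colour v = parity (depth v)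

    child-colour : ∀ {x c} → Child x c → colour c ≡ colour x ⁻¹
    child-colour {x} x→c = trans (cong parity (child-depth x→c)) (sym (⁻¹-selfInverse (suc-homo-⁻¹ (depth x))))

    adj-colour : ∀ {u v} → Adj u v → colour v ≡ colour u ⁻¹
    adj-colour uv with edge-parent uv
    ... | inj₁ u→v = child-colour u→v
    ... | inj₂ v→u = sym (⁻¹-selfInverse (sym (child-colour v→u)))

    adj⇒colour≢ : ∀ {u v} → Adj u v → colour u ≢ colour v
    adj⇒colour≢ {u} uv cu≡cv = p≢p⁻¹ (colour u) (trans cu≡cv (adj-colour uv))

    P4Ends⇒colour≢ : ∀ {a d} → P4Ends G a d → colour a ≢ colour d
    P4Ends⇒colour≢ {a} {d} (b , c , ab , bc , cd , _) ca≡cd = p≢p⁻¹ (colour a) (begin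
      colour a              ≡⟨ ca≡cd ⟩
      colour d              ≡⟨ adj-colour cd ⟩
      colour c ⁻¹           ≡⟨ cong _⁻¹ (adj-colour bc) ⟩
      colour b ⁻¹ ⁻¹        ≡⟨ ⁻¹-involutive (colour b) ⟩
      colour b              ≡⟨ adj-colour ab ⟩
      colour a ⁻¹           ∎)
      where open ≡-Reasoning

    #P4Ends≤2*halfProduct[n∸2] : #P4Ends G ≤ 2 * halfProduct (n ∸ 2)
    #P4Ends≤2*halfProduct[n∸2] = begin
      #P4Ends G                         ≤⟨ m+n≤o⇒m≤o∸n (#P4Ends G) P4Ends+edges≤2W₀W₁ ⟩
      2 * (W₀ * W₁) ∸ 2 * (n ∸ 1)       ≡⟨ sym (*-distribˡ-∸ 2 (W₀ * W₁) (n ∸ 1)) ⟩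
      2 * (W₀ * W₁ ∸ (n ∸ 1))           ≡⟨ cong (λ k → 2 * (W₀ * W₁ ∸ (k ∸ 1))) (sym W₀+W₁≡n) ⟩
      2 * (W₀ * W₁ ∸ (W₀ + W₁ ∸ 1))     ≤⟨ *-monoʳ-≤ 2 (m*n∸[m+n∸1]≤halfProduct[m+n∸2] W₀ W₁) ⟩
      2 * halfProduct (W₀ + W₁ ∸ 2)     ≡⟨ cong (λ k → 2 * halfProduct (k ∸ 2)) W₀+W₁≡n ⟩
      2 * halfProduct (n ∸ 2)           ∎
      where
      open ≤-Reasoning
      one : Fin n → ℕ
      one _ = 1
      W₀ W₁ : ℕ
      W₀ = colourWeight colour one 0ℙ
      W₁ = colourWeight colour one 1ℙ
      W₀+W₁≡n : W₀ + W₁ ≡ n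
      W₀+W₁≡n = trans (colourWeight-sum colour one) (trans (sum-const n 1) (*-identityʳ n))
      P4Ends-or-adj? : ∀ a d → Dec (P4Ends G a d ⊎ Adj a d)
      P4Ends-or-adj? a d = p4Ends? G a d ⊎-dec adj? a d
      P4Ends+edges≤2W₀W₁ : #P4Ends G + 2 * (n ∸ 1) ≤ 2 * (W₀ * W₁)
      P4Ends+edges≤2W₀W₁ = begin
        #P4Ends G + 2 * (n ∸ 1)
          ≤⟨ +-monoʳ-≤ (#P4Ends G) 2[n∸1]≤∑∑𝟙adj ⟩
        #P4Ends G + ∑[ a < n ] ∑[ d < n ] 𝟙 (adj? a d)
          ≡⟨ sym (∑∑-distrib-+ {n} {n} _ _) ⟩
        ∑[ a < n ] ∑[ d < n ] (𝟙 (p4Ends? G a d) + 𝟙 (adj? a d))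
          ≡⟨ sum-cong-≗ {n} (λ a → sum-cong-≗ {n} λ d →
               sym (𝟙-⊎ (λ ((_ , _ , abcd) , ad) → OrderedP4⇒¬Adj G acyclic abcd ad) (p4Ends? G a d) (adj? a d))) ⟩
        ∑[ a < n ] ∑[ d < n ] 𝟙 (P4Ends-or-adj? a d)
          ≡⟨ sym (pairSum-ones (λ a d → 𝟙 (P4Ends-or-adj? a d))) ⟩
        pairSum one one (λ a d → 𝟙 (P4Ends-or-adj? a d))
          ≤⟨ pairSum-bipartite colour P4Ends-or-adj? [ P4Ends⇒colour≢ , adj⇒colour≢ ] one ⟩
        2 * (W₀ * W₁) ∎

module AlongPath {n m} (G : Graph n) (tree : IsTree G) (path : Fin (suc m) → Fin n)
  (path-injective : Injective _≡_ _≡_ path)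
  (path-adj : ∀ (i : Fin (suc m)) (i+1<s : suc (toℕ i) < suc m) → Graph.Adj G (path i) (path (fromℕ< i+1<s)))
  where

  open Graph G using (Adj)
  open Rooted G (proj₁ tree) (path fzero)
  open Tree (proj₂ tree)

  -- The bound is irrelevant, so that at k does not depend on which proof of k < suc m is supplied.
  at : ∀ k → .(k < suc m) → Fin n
  at k k<s = path (fromℕ< k<s)

  path≡at : ∀ i → path i ≡ at (toℕ i) (toℕ<n i)
  path≡at i = cong path (sym (fromℕ<-toℕ i (toℕ<n i)))

  at-adj : ∀ k (k+1<s : suc k < suc m) → Adj (at k (<-trans (n<1+n k) k+1<s)) (at (suc k) k+1<s)
  at-adj k k+1<s =
    subst (λ j → Adj (at k k<s) (path j)) (fromℕ<-cong _ _ (cong suc (toℕ-fromℕ< k<s)) i+1<s k+1<s)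
          (path-adj (fromℕ< k<s) i+1<s)
    where
    k<s : k < suc m
    k<s = <-trans (n<1+n k) k+1<s
    i+1<s : suc (toℕ (fromℕ< k<s)) < suc m
    i+1<s = subst (λ j → suc j < suc m) (sym (toℕ-fromℕ< k<s)) k+1<s

  at-child : ∀ k (k+1<s : suc k < suc m) → Child (at k (<-trans (n<1+n k) k+1<s)) (at (suc k) k+1<s)
  at-child zero k+1<s with edge-parent (at-adj zero k+1<s)
  ... | inj₁ 0→1       = 0→1
  ... | inj₂ (0≢0 , _) = contradiction refl 0≢0
  at-child (suc k) k+2<s with edge-parent (at-adj (suc k) k+2<s)
  ... | inj₁ k+1→k+2       = k+1→k+2
  ... | inj₂ (_ , pk+1≡k+2) = ⊥-elim (<-irrefl k≡k+2 (m<n⇒m<1+n (n<1+n k)))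
    where
    k<s : k < suc m
    k<s = <-trans (n<1+n k) (<-trans (n<1+n (suc k)) k+2<s)
    k≡k+2 : k ≡ suc (suc k)
    k≡k+2 = fromℕ<-injective k (suc (suc k)) k<s k+2<s (path-injective
              (trans (sym (proj₂ (at-child k (<-trans (n<1+n (suc k)) k+2<s)))) pk+1≡k+2))

  depth-at : ∀ k (k<s : k < suc m) → depth (at k k<s) ≡ k
  depth-at zero    _   = depth-root
  depth-at (suc k) k<s = trans (child-depth (at-child k k<s)) (cong suc (depth-at k (<-trans (n<1+n k) k<s)))

  depth-path : ∀ i → depth (path i) ≡ toℕ i
  depth-path i = trans (cong depth (path≡at i)) (depth-at (toℕ i) (toℕ<n i))

  OnPath : Fin n → Set
  OnPath a = ∃ λ i → path i ≡ a

  onPath? : ∀ a → Dec (OnPath a)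
  onPath? a = any? λ i → path i ≟ a

  onPath-depth-injective : ∀ {a b} → OnPath a → OnPath b → depth a ≡ depth b → a ≡ b
  onPath-depth-injective (i , refl) (j , refl) e =
    cong path (toℕ-injective (trans (sym (depth-path i)) (trans e (depth-path j))))

  onPath-parent : ∀ {c} → OnPath c → c ≢ path fzero → OnPath (parent c)
  onPath-parent (fzero  , refl) c≢root = contradiction refl c≢root
  onPath-parent (fsuc j , refl) _      =
    fromℕ< (<-trans (n<1+n (toℕ j)) (toℕ<n (fsuc j))) ,
    sym (trans (cong parent (path≡at (fsuc j))) (proj₂ (at-child (toℕ j) (toℕ<n (fsuc j)))))

  onPath-parentOf : ∀ {x c} → Child x c → OnPath c → OnPath x
  onPath-parentOf (c≢root , pc≡x) c∈path = subst OnPath pc≡x (onPath-parent c∈path c≢root)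

  offPath-child : ∀ {x c} → ¬ OnPath x → Child x c → ¬ OnPath c
  offPath-child ¬x x→c = ¬x ∘ onPath-parentOf x→c

  onPath-siblings : ∀ {x c c′} → OnPath c → OnPath c′ → Child x c → Child x c′ → c ≡ c′
  onPath-siblings c∈ c′∈ x→c x→c′ = onPath-depth-injective c∈ c′∈ (trans (child-depth x→c) (sym (child-depth x→c′)))

  depth-path-+3 : ∀ i j → depth (path j) ≡ depth (path i) + 3 → toℕ j ≡ toℕ i + 3
  depth-path-+3 i j e = trans (sym (depth-path j)) (trans e (cong (_+ 3) (depth-path i)))

  P4Ends-onPath : ∀ i j → P4Ends G (path i) (path j) → toℕ j ≡ toℕ i + 3 ⊎ toℕ i ≡ toℕ j + 3
  P4Ends-onPath i j (b , c , abcd@(_ , _ , _ , _ , a≢c , _ , _ , b≢d , _)) with shape abcd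
  ... | ↑↑↑ b→a c→b d→c = inj₂ (depth-path-+3 j i (depth-great-grandchild d→c c→b b→a))
  ... | ↓↓↓ a→b b→c c→d = inj₁ (depth-path-+3 i j (depth-great-grandchild a→b b→c c→d))
  ... | ↑↑↓ b→a c→b c→d = contradiction (onPath-siblings (onPath-parentOf b→a (i , refl)) (j , refl) c→b c→d) b≢d
  ... | ↑↓↓ b→a b→c c→d = contradiction (onPath-siblings (i , refl) (onPath-parentOf c→d (j , refl)) b→a b→c) a≢c

  -- Apart from ancestor 3 a, a path vertex ending a P₄ that starts at an off-path vertex a has this depth:
  -- it lies two steps below a's parent if that parent is on the path, and is a sibling of it otherwise.
  pathPartnerDepth : Fin n → ℕ
  pathPartnerDepth a with onPath? (parent a)
  ... | yes _ = suc (depth a)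
  ... | no _  = pred (depth a)

  pathPartnerDepth-on : ∀ {a} → OnPath (parent a) → pathPartnerDepth a ≡ suc (depth a)
  pathPartnerDepth-on {a} pa∈ with onPath? (parent a)
  ... | yes _   = refl
  ... | no pa∉  = contradiction pa∈ pa∉

  pathPartnerDepth-off : ∀ {a} → ¬ OnPath (parent a) → pathPartnerDepth a ≡ pred (depth a)
  pathPartnerDepth-off {a} pa∉ with onPath? (parent a)
  ... | yes pa∈ = contradiction pa∈ pa∉
  ... | no _    = refl

  P4Ends-offPath : ∀ {a d} → ¬ OnPath a → OnPath d → P4Ends G a d → d ≡ ancestor 3 a ⊎ depth d ≡ pathPartnerDepth a
  P4Ends-offPath {a} {d} a∉ d∈ (b , c , abcd@(_ , _ , _ , _ , _ , _ , _ , b≢d , _)) with shape abcd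
  ... | ↑↑↑ (_ , pa≡b) (_ , pb≡c) (_ , pc≡d) =
    inj₁ (sym (trans (cong (parent ∘ parent) pa≡b) (trans (cong parent pb≡c) pc≡d)))
  ... | ↓↓↓ a→b b→c c→d = contradiction d∈ (offPath-child (offPath-child (offPath-child a∉ a→b) b→c) c→d)
  ... | ↑↑↓ b→a c→b c→d = inj₂ (begin
    depth d             ≡⟨ trans (child-depth c→d) (sym (child-depth c→b)) ⟩
    depth b             ≡⟨ cong pred (sym (child-depth b→a)) ⟩
    pred (depth a)      ≡⟨ sym (pathPartnerDepth-off pa∉) ⟩
    pathPartnerDepth a  ∎)
    where
    open ≡-Reasoning
    pa∉ : ¬ OnPath (parent a)
    pa∉ pa∈ = b≢d (onPath-siblings (subst OnPath (proj₂ b→a) pa∈) d∈ c→b c→d)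
  ... | ↑↓↓ b→a b→c c→d = inj₂ (begin
    depth d             ≡⟨ trans (child-depth c→d) (cong suc (child-depth b→c)) ⟩
    suc (suc (depth b)) ≡⟨ cong suc (sym (child-depth b→a)) ⟩
    suc (depth a)       ≡⟨ sym (pathPartnerDepth-on pa∈) ⟩
    pathPartnerDepth a  ∎)
    where
    open ≡-Reasoning
    pa∈ : OnPath (parent a)
    pa∈ = subst OnPath (sym (proj₂ b→a)) (onPath-parentOf b→c (onPath-parentOf c→d d∈))

  on off : Fin n → ℕ
  on  a = 𝟙 (onPath? a)
  off a = 𝟙 (¬? (onPath? a))

  ends : Fin n → Fin n → ℕ
  ends a d = 𝟙 (p4Ends? G a d)

  ∑on≡s : ∑[ a < n ] on a ≡ suc m
  ∑on≡s = begin
    ∑[ a < n ] on a          ≡⟨ sum-cong-≗ {n} (λ a → sym (*-identityʳ (on a))) ⟩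
    ∑[ a < n ] (on a * 1)    ≡⟨ ∑-image path-injective (λ _ → 1) ⟩
    ∑[ i < suc m ] 1         ≡⟨ trans (sum-const (suc m) 1) (*-identityʳ (suc m)) ⟩
    suc m                    ∎
    where open ≡-Reasoning

  ∑off≡n∸s : ∑[ a < n ] off a ≡ n ∸ suc m
  ∑off≡n∸s = trans (∑𝟙¬ onPath?) (cong (n ∸_) ∑on≡s)

  pairSum-onPath : ∀ e → pairSum on on e ≡ ∑[ i < suc m ] ∑[ j < suc m ] e (path i) (path j)
  pairSum-onPath e = begin
    pairSum on on e                                         ≡⟨ pairSum-nested on on e ⟩
    ∑[ a < n ] (on a * ∑[ d < n ] (on d * e a d))           ≡⟨ sum-cong-≗ {n} (λ a → cong (on a *_) (∑-image path-injective (e a))) ⟩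
    ∑[ a < n ] (on a * ∑[ j < suc m ] e a (path j))         ≡⟨ ∑-image path-injective (λ a → ∑[ j < suc m ] e a (path j)) ⟩
    ∑[ i < suc m ] ∑[ j < suc m ] e (path i) (path j)       ∎
    where open ≡-Reasoning

  on-on≤ : pairSum on on ends ≤ 2 * (suc m ∸ 3)
  on-on≤ = begin
    pairSum on on ends
      ≡⟨ pairSum-onPath ends ⟩
    ∑[ i < suc m ] ∑[ j < suc m ] ends (path i) (path j)
      ≤⟨ sum-mono-≤ {suc m} (λ i → sum-mono-≤ {suc m} (λ j →
           𝟙-mono-⊎ (P4Ends-onPath i j) (p4Ends? G (path i) (path j)) (toℕ j ℕ.≟ toℕ i + 3) (toℕ i ℕ.≟ toℕ j + 3))) ⟩
    ∑[ i < suc m ] ∑[ j < suc m ] (3-apart i j + 3-apart j i)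
      ≡⟨ ∑∑-distrib-+ {suc m} {suc m} 3-apart (λ i j → 3-apart j i) ⟩
    ∑[ i < suc m ] ∑[ j < suc m ] 3-apart i j + ∑[ i < suc m ] ∑[ j < suc m ] 3-apart j i
      ≡⟨ cong (∑[ i < suc m ] ∑[ j < suc m ] 3-apart i j +_) (∑-comm {suc m} {suc m} (λ i j → 3-apart j i)) ⟩
    ∑[ i < suc m ] ∑[ j < suc m ] 3-apart i j + ∑[ j < suc m ] ∑[ i < suc m ] 3-apart j i
      ≤⟨ +-mono-≤ (∑∑𝟙[≡+]≤∸ (suc m) 3) (∑∑𝟙[≡+]≤∸ (suc m) 3) ⟩
    (suc m ∸ 3) + (suc m ∸ 3)
      ≡⟨ cong (suc m ∸ 3 +_) (sym (+-identityʳ (suc m ∸ 3))) ⟩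
    2 * (suc m ∸ 3) ∎
    where
    open ≤-Reasoning
    3-apart : Fin (suc m) → Fin (suc m) → ℕ
    3-apart i j = 𝟙 (toℕ j ℕ.≟ toℕ i + 3)

  offPath-partners≤2 : ∀ {a} → ¬ OnPath a → ∑[ d < n ] (on d * ends a d) ≤ 2
  offPath-partners≤2 {a} a∉ = begin
    ∑[ d < n ] (on d * ends a d)
      ≡⟨ sum-cong-≗ {n} (λ d → sym (𝟙-× (onPath? d) (p4Ends? G a d))) ⟩
    ∑[ d < n ] 𝟙 (onPath? d ×-dec p4Ends? G a d)
      ≤⟨ sum-mono-≤ {n} (λ d → 𝟙-mono-⊎ (λ (d∈ , ad) → Sum.map₂ (d∈ ,_) (P4Ends-offPath a∉ d∈ ad))
           (onPath? d ×-dec p4Ends? G a d) (d ≟ ancestor 3 a) (onPath? d ×-dec depth d ℕ.≟ pathPartnerDepth a)) ⟩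
    ∑[ d < n ] (𝟙 (d ≟ ancestor 3 a) + 𝟙 (onPath? d ×-dec depth d ℕ.≟ pathPartnerDepth a))
      ≡⟨ ∑-distrib-+ {n} _ _ ⟩
    ∑[ d < n ] 𝟙 (d ≟ ancestor 3 a) + ∑[ d < n ] 𝟙 (onPath? d ×-dec depth d ℕ.≟ pathPartnerDepth a)
      ≤⟨ +-mono-≤ (≤-reflexive (∑𝟙≟ (ancestor 3 a)))
                  (∑𝟙≤1 (λ d → onPath? d ×-dec depth d ℕ.≟ pathPartnerDepth a)
                        (λ (d∈ , e) (d′∈ , e′) → onPath-depth-injective d∈ d′∈ (trans e (sym e′)))) ⟩
    2 ∎
    where open ≤-Reasoning

  off-on≤ : pairSum off on ends ≤ (n ∸ suc m) * 2
  off-on≤ = begin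
    pairSum off on ends                                ≡⟨ pairSum-nested off on ends ⟩
    ∑[ a < n ] (off a * ∑[ d < n ] (on d * ends a d))  ≤⟨ sum-mono-≤ {n} partners≤2 ⟩
    ∑[ a < n ] (off a * 2)                          ≡⟨ sym (*-distribʳ-sum 2 off) ⟩
    ∑[ a < n ] off a * 2                            ≡⟨ cong (_* 2) ∑off≡n∸s ⟩
    (n ∸ suc m) * 2                                 ∎
    where
    open ≤-Reasoning
    partners≤2 : ∀ a → off a * ∑[ d < n ] (on d * ends a d) ≤ off a * 2
    partners≤2 a = by-cases (onPath? a)
      where
      by-cases : (a∈? : Dec (OnPath a)) → 𝟙 (¬? a∈?) * ∑[ d < n ] (on d * ends a d) ≤ 𝟙 (¬? a∈?) * 2
      by-cases (yes _) = z≤n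
      by-cases (no a∉) = *-monoʳ-≤ 1 (offPath-partners≤2 a∉)

  off-off≤ : pairSum off off ends ≤ 2 * halfProduct (n ∸ suc m)
  off-off≤ = subst (λ k → pairSum off off ends ≤ 2 * halfProduct k) ∑off≡n∸s
                  (pairSum-bipartite-halfProduct colour (p4Ends? G) P4Ends⇒colour≢ off)

  #P4Ends≤ : #P4Ends G ≤ 2 * ((suc m ∸ 3) + 2 * (n ∸ suc m) + halfProduct (n ∸ suc m))
  #P4Ends≤ = begin
    #P4Ends G
      ≡⟨ pairSum-split on off ends (λ a → 𝟙+𝟙¬ (onPath? a)) ⟩
    (pairSum on on ends + pairSum on off ends) + (pairSum off on ends + pairSum off off ends)
      ≡⟨ cong (λ t → (pairSum on on ends + t) + (pairSum off on ends + pairSum off off ends))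
              (pairSum-swap on off ends (λ a d → 𝟙-cong (P4Ends-sym G) (P4Ends-sym G) (p4Ends? G a d) (p4Ends? G d a))) ⟩
    (pairSum on on ends + pairSum off on ends) + (pairSum off on ends + pairSum off off ends)
      ≤⟨ +-mono-≤ (+-mono-≤ on-on≤ off-on≤) (+-mono-≤ off-on≤ off-off≤) ⟩
    (2 * (suc m ∸ 3) + (n ∸ suc m) * 2) + ((n ∸ suc m) * 2 + 2 * halfProduct (n ∸ suc m))
      ≡⟨ collect (suc m ∸ 3) (n ∸ suc m) (halfProduct (n ∸ suc m)) ⟩
    2 * ((suc m ∸ 3) + 2 * (n ∸ suc m) + halfProduct (n ∸ suc m)) ∎
    where
    open ≤-Reasoning
    collect : ∀ x y z → (2 * x + y * 2) + (y * 2 + 2 * z) ≡ 2 * (x + 2 * y + z)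
    collect = solve-∀

lemma4p4 : ∀ (n s : ℕ) (T : Graph n) → 4 ≤ s → s ≤ n → IsTree T → ContainsPath T s → #P4 T ≤ f n s
lemma4p4 n .(suc m) T (s≤s {n = m} _) _ tree@(connected , acyclic) (path , path-injective , path-adj)
  rewrite #orderedP4≡#P4Ends T acyclic with 6 ≤? suc m
... | yes _ = halve (AlongPath.#P4Ends≤ T tree path path-injective path-adj)
... | no _  = halve (Rooted.Tree.#P4Ends≤2*halfProduct[n∸2] T connected (path fzero) acyclic)
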